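{- Let $\alpha=\{a_1,\dots,a_n\}$ be a set of $n$ elements, $\delta<n$ a non-negative integer, and $\Gamma_1:\alpha\to\{0,1,\dots,n\}$ a total mapping. Let $\beta=\{j>0: 0<|\{x:\Gamma_1(x)=j\}|\le\delta\}$, and suppose $\beta\neq\emptyset$ and $$|\{x:\Gamma_1(x)=0\}|=\sum_{j\in\beta}\bigl(\delta-|\{x:\Gamma_1(x)=j\}|+1\bigr).$$ Then for every total mapping $\Gamma_2:\alpha\to\{0,1,\dots,n\}$ satisfying $\Gamma_2(x)=\Gamma_1(x)$ for every $x$ with $\Gamma_1(x)>0$: if there exists $y\in\alpha$ with $\Gamma_1(y)=0$ and $\Gamma_2(y)=k$ for some $k\notin\beta$, then $\Gamma_2$ is not a $\delta$-partition of $\alpha$.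
   Context: A total mapping $\Gamma:\alpha\to\{0,1,\dots,n\}$ is a partition of $\alpha$ if $\Gamma(x)\neq0$ for all $x\in\alpha$. It is a $\delta$-partition of $\alpha$ if it is a partition of $\alpha$ and $|\{x:\Gamma(x)=i\}|>\delta$ for every $i\in\{1,\dots,n\}$ with $\{x:\Gamma(x)=i\}\neq\emptyset$ (i.e. every nonempty part has more than $\delta$ elements). -}

module Defs where

open import Data.Nat using (ℕ; zero; suc; _+_; _∸_; _≤_; _<_; _≤?_; _<?_)
open import Data.Fin using (Fin; zero; suc; toℕ; _≟_)
open import Data.List using (List; length; filter; map; allFin)
open import Data.Nat.ListAction using (sum)
open import Data.Product using (_×_)
open import Relation.Nullary using (¬_; Dec; yes; no)
open import Relation.Nullary.Decidable using (_×-dec_; ¬?)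

-- α = {a_1,…,a_n} is modelled as Fin n; a total mapping α → {0,…,n} as Fin n → Fin (suc n).
Mapping : ℕ → Set
Mapping n = Fin n → Fin (suc n)

card : ∀ {n} → Mapping n → Fin (suc n) → ℕ
card {n} Γ j = length (filter (λ x → Γ x ≟ j) (allFin n))

IsPartition : ∀ {n} → Mapping n → Set
IsPartition {n} Γ = (x : Fin n) → ¬ (Γ x ≡ zero)
  where open import Relation.Binary.PropositionalEquality using (_≡_)

IsDeltaPartition : ∀ {n} → ℕ → Mapping n → Set
IsDeltaPartition {n} δ Γ =
  IsPartition Γ × ((i : Fin (suc n)) → ¬ (i ≡ zero) → 0 < card Γ i → δ < card Γ i)
  where open import Relation.Binary.PropositionalEquality using (_≡_)

InBeta : ∀ {n} → ℕ → Mapping n → Fin (suc n) → Set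
InBeta δ Γ j = ¬ (j ≡ zero) × (0 < card Γ j) × (card Γ j ≤ δ)
  where open import Relation.Binary.PropositionalEquality using (_≡_)

inBeta? : ∀ {n} (δ : ℕ) (Γ : Mapping n) (j : Fin (suc n)) → Dec (InBeta δ Γ j)
inBeta? δ Γ j = ¬? (j ≟ zero) ×-dec ((0 <? card Γ j) ×-dec (card Γ j ≤? δ))

beta : ∀ {n} → ℕ → Mapping n → List (Fin (suc n))
beta {n} δ Γ = filter (inBeta? δ Γ) (allFin (suc n))

-- Σ_{j∈β} (δ − |Γ⁻¹(j)| + 1)   (truncated subtraction is harmless since |Γ⁻¹(j)| ≤ δ on β)
betaSum : ∀ {n} → ℕ → Mapping n → ℕ
betaSum δ Γ = sum (map (λ j → δ ∸ card Γ j + 1) (beta δ Γ))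

-- Let Z be the zero fibre of Γ₁. Off Z the mappings agree, so for j ≠ 0 the fibre
-- Γ₂⁻¹(j) is Γ₁⁻¹(j) enlarged by the points of Z that Γ₂ sends to j. If Γ₂ were a δ-partition,
-- every j ∈ β would need at least δ − |Γ₁⁻¹(j)| + 1 such points, and as β consists of distinct
-- values these demands add up: Γ₂ would send at least betaSum = |Z| points of Z into β. But y ∈ Z
-- is sent outside β.
module Submission where

open import Defs
open import Data.Nat using (ℕ; zero; suc; _+_; _∸_; _≤_; _<_; z≤n; s≤s)
open import Data.Nat.Properties using (+-comm; +-suc; +-mono-≤; ≤-trans; ≤-<-trans; m≤m+n; <-irrefl; +-commutativeSemigroup)
open import Data.Nat.ListAction using (sum)
open import Data.Bool using (if_then_else_)
open import Data.Fin using (Fin; zero)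
open import Data.Fin.Properties using (_≟_)
open import Data.List using (List; []; _∷_; length; filter; map; allFin)
open import Data.List.Properties using (map-cong; filter-notAll)
open import Data.List.Membership.Propositional using (_∈_; lose)
open import Data.List.Membership.Propositional.Properties using (∈-filter⁺; ∈-filter⁻; ∈-allFin)
open import Data.List.Relation.Unary.Any using (here; there; any?)
open import Data.List.Relation.Unary.AllPairs using ([]; _∷_)
open import Data.List.Relation.Unary.All.Properties using (All¬⇒¬Any)
open import Data.List.Relation.Unary.Unique.Propositional using (Unique)
import Data.List.Relation.Unary.Unique.Propositional.Properties as Unique
open import Data.Product using (Σ; _,_; proj₂)
open import Data.Empty using (⊥-elim)
open import Relation.Nullary using (¬_; Dec; does; yes; no)
open import Relation.Binary using (DecidableEquality)
open import Relation.Binary.PropositionalEquality using (_≡_; refl; sym; trans; cong; cong₂; subst; module ≡-Reasoning)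
open import Algebra.Properties.CommutativeSemigroup +-commutativeSemigroup using (interchange)

open ≡-Reasoning

𝟙 : {P : Set} → Dec P → ℕ
𝟙 P? = if does P? then 1 else 0

𝟙-no : {P : Set} → ¬ P → (P? : Dec P) → 𝟙 P? ≡ 0
𝟙-no ¬p (yes p) = ⊥-elim (¬p p)
𝟙-no ¬p (no _) = refl

length-filter-∷ : {A : Set} {P : A → Set} (P? : (x : A) → Dec (P x)) (x : A) (xs : List A) →
  length (filter P? (x ∷ xs)) ≡ 𝟙 (P? x) + length (filter P? xs)
length-filter-∷ P? x xs with P? x
... | yes _ = refl
... | no _ = refl

sum-map-+ : {A : Set} (f g : A → ℕ) (xs : List A) →
  sum (map (λ x → f x + g x) xs) ≡ sum (map f xs) + sum (map g xs)
sum-map-+ f g [] = refl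
sum-map-+ f g (x ∷ xs) = trans (cong (f x + g x +_) (sum-map-+ f g xs))
                               (interchange (f x) (g x) (sum (map f xs)) (sum (map g xs)))

sum-map-mono-≤ : {A : Set} {f g : A → ℕ} (xs : List A) → (∀ {x} → x ∈ xs → f x ≤ g x) →
  sum (map f xs) ≤ sum (map g xs)
sum-map-mono-≤ [] f≤g = z≤n
sum-map-mono-≤ (x ∷ xs) f≤g = +-mono-≤ (f≤g (here refl)) (sum-map-mono-≤ xs (λ x∈xs → f≤g (there x∈xs)))

∸-+1-≤ : ∀ {m n o} → m ≤ n → n < m + o → n ∸ m + 1 ≤ o
∸-+1-≤ {zero} {n} {o} _ n<o = subst (_≤ o) (+-comm 1 n) n<o
∸-+1-≤ {suc m} (s≤s m≤n) (s≤s n<m+o) = ∸-+1-≤ m≤n n<m+o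

module Fibres {B : Set} (_≟ᴮ_ : DecidableEquality B) where

  -- Unlike the _∈?_ of Data.List.Membership.DecPropositional, this one unfolds to v ≟ᴮ b on
  -- b ∷ bs syntactically, which sum-𝟙-≟ needs for its with-abstraction.
  _∈?_ : (v : B) (bs : List B) → Dec (v ∈ bs)
  v ∈? bs = any? (v ≟ᴮ_) bs

  fibreSize : {A : Set} → (A → B) → List A → B → ℕ
  fibreSize f xs b = length (filter (λ x → f x ≟ᴮ b) xs)

  sum-𝟙-≟ : (v : B) {bs : List B} → Unique bs → sum (map (λ b → 𝟙 (v ≟ᴮ b)) bs) ≡ 𝟙 (v ∈? bs)
  sum-𝟙-≟ v [] = refl
  sum-𝟙-≟ v {b ∷ bs} (b∉bs ∷ bs!) with v ≟ᴮ b
  ... | yes refl = cong suc (trans (sum-𝟙-≟ v bs!) (𝟙-no (All¬⇒¬Any b∉bs) (v ∈? bs)))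
  ... | no _ = sum-𝟙-≟ v bs!

  sum-fibreSize : {A : Set} (f : A → B) (xs : List A) {bs : List B} → Unique bs →
    sum (map (fibreSize f xs) bs) ≡ length (filter (λ x → f x ∈? bs) xs)
  sum-fibreSize f [] {bs} _ = sum-zero bs
    where
    sum-zero : (bs : List B) → sum (map (λ _ → 0) bs) ≡ 0
    sum-zero [] = refl
    sum-zero (_ ∷ bs) = sum-zero bs
  sum-fibreSize f (x ∷ xs) {bs} bs! = begin
    sum (map (fibreSize f (x ∷ xs)) bs)
      ≡⟨ cong sum (map-cong (λ b → length-filter-∷ (λ x → f x ≟ᴮ b) x xs) bs) ⟩
    sum (map (λ b → 𝟙 (f x ≟ᴮ b) + fibreSize f xs b) bs)
      ≡⟨ sum-map-+ (λ b → 𝟙 (f x ≟ᴮ b)) (fibreSize f xs) bs ⟩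
    sum (map (λ b → 𝟙 (f x ≟ᴮ b)) bs) + sum (map (fibreSize f xs) bs)
      ≡⟨ cong₂ _+_ (sum-𝟙-≟ (f x) bs!) (sum-fibreSize f xs bs!) ⟩
    𝟙 (f x ∈? bs) + length (filter (λ x → f x ∈? bs) xs)
      ≡⟨ sym (length-filter-∷ (λ x → f x ∈? bs) x xs) ⟩
    length (filter (λ x → f x ∈? bs) (x ∷ xs)) ∎

  sum-fibreSize-< : {A : Set} (f : A → B) (xs : List A) {bs : List B} → Unique bs →
    {y : A} → y ∈ xs → ¬ f y ∈ bs → sum (map (fibreSize f xs) bs) < length xs
  sum-fibreSize-< f xs {bs} bs! y∈xs fy∉bs rewrite sum-fibreSize f xs bs! =
    filter-notAll (λ x → f x ∈? bs) xs (lose y∈xs fy∉bs)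

  fibreSize-redefine : {A : Set} {f g : A → B} {z b : B} →
    (∀ x → ¬ f x ≡ z → g x ≡ f x) → ¬ b ≡ z → (xs : List A) →
    fibreSize g xs b ≡ fibreSize f xs b + fibreSize g (filter (λ x → f x ≟ᴮ z) xs) b
  fibreSize-redefine agree b≢z [] = refl
  fibreSize-redefine {f = f} {g} {z} {b} agree b≢z (x ∷ xs) with f x ≟ᴮ z
  ... | yes fx≡z with g x ≟ᴮ b | f x ≟ᴮ b
  ...   | _        | yes fx≡b = ⊥-elim (b≢z (trans (sym fx≡b) fx≡z))
  ...   | yes _    | no _     = trans (cong suc (fibreSize-redefine agree b≢z xs)) (sym (+-suc _ _))
  ...   | no _     | no _     = fibreSize-redefine agree b≢z xs
  fibreSize-redefine {f = f} {g} {z} {b} agree b≢z (x ∷ xs) | no fx≢z with g x ≟ᴮ b | f x ≟ᴮ b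
  ...   | yes gx≡b | no fx≢b  = ⊥-elim (fx≢b (trans (sym (agree x fx≢z)) gx≡b))
  ...   | no gx≢b  | yes fx≡b = ⊥-elim (gx≢b (trans (agree x fx≢z) fx≡b))
  ...   | yes _    | yes _    = cong suc (fibreSize-redefine agree b≢z xs)
  ...   | no _     | no _     = fibreSize-redefine agree b≢z xs

proposition3 : (n δ : ℕ) → δ < n → (Γ₁ : Mapping n) →
    Σ (Fin (suc n)) (InBeta δ Γ₁) →
    card Γ₁ zero ≡ betaSum δ Γ₁ →
    (Γ₂ : Mapping n) →
    ((x : Fin n) → ¬ (Γ₁ x ≡ zero) → Γ₂ x ≡ Γ₁ x) →
    (y : Fin n) → (k : Fin (suc n)) → Γ₁ y ≡ zero → Γ₂ y ≡ k → ¬ InBeta δ Γ₁ k →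
    ¬ IsDeltaPartition δ Γ₂
proposition3 n δ _ Γ₁ _ zeros≡betaSum Γ₂ agree y k Γ₁y≡0 Γ₂y≡k k∉β (_ , bigParts) =
  <-irrefl (sym zeros≡betaSum) (≤-<-trans betaSum≤moved moved<zeros)
  where
  open Fibres (_≟_ {suc n})
  Z : List (Fin n)
  Z = filter (λ x → Γ₁ x ≟ zero) (allFin n)
  β : List (Fin (suc n))
  β = beta δ Γ₁
  β! : Unique β
  β! = Unique.filter⁺ (inBeta? δ Γ₁) (Unique.allFin⁺ (suc n))
  inBeta : ∀ {j} → j ∈ β → InBeta δ Γ₁ j
  inBeta j∈β = proj₂ (∈-filter⁻ (inBeta? δ Γ₁) {xs = allFin (suc n)} j∈β)
  moved<zeros : sum (map (fibreSize Γ₂ Z) β) < card Γ₁ zero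
  moved<zeros = sum-fibreSize-< Γ₂ Z β! (∈-filter⁺ (λ x → Γ₁ x ≟ zero) (∈-allFin y) Γ₁y≡0)
                  (λ Γ₂y∈β → k∉β (subst (InBeta δ Γ₁) Γ₂y≡k (inBeta Γ₂y∈β)))
  demand≤moved : ∀ {j} → j ∈ β → δ ∸ card Γ₁ j + 1 ≤ fibreSize Γ₂ Z j
  demand≤moved {j} j∈β with j≢0 , nonempty , small ← inBeta j∈β =
    ∸-+1-≤ small (subst (δ <_) split (bigParts j j≢0 nonempty₂))
    where
    split : card Γ₂ j ≡ card Γ₁ j + fibreSize Γ₂ Z j
    split = fibreSize-redefine agree j≢0 (allFin n)
    nonempty₂ : 0 < card Γ₂ j
    nonempty₂ = subst (0 <_) (sym split) (≤-trans nonempty (m≤m+n _ _))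
  betaSum≤moved : betaSum δ Γ₁ ≤ sum (map (fibreSize Γ₂ Z) β)
  betaSum≤moved = sum-map-mono-≤ β demand≤moved
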